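{- An instance $D=(V,A)$ of Directed Reachability Graph Realizability is a yes-instance if (i) the variant is Any-Strict or Simple-Strict, or (ii) $D$ is a directed acyclic graph, or (iii) $D$ is transitive (for every distinct $u,v,w\in V$ with $(u,v)\in A$ and $(v,w)\in A$ we have $(u,w)\in A$); cases (ii) and (iii) apply to every variant (Any-Strict, Any-Non-strict, Simple-Strict, Simple-Non-strict, Proper, Happy).
   Context: A directed temporal graph is a pair $(H,\lambda)$ where $H=(V,B)$ is a simple digraph and $\lambda:B\to 2^{\mathbb{N}}$ assigns each arc a finite, possibly empty, set of labels. A strict (resp. non-strict) temporal path from $u$ to $v$ is a sequence $(a_1,t_1),\dots,(a_\ell,t_\ell)$, $t_j\in\lambda(a_j)$, such that $a_1,\dots,a_\ell$ form a directed $u$-$v$ path and $t_1<\dots<t_\ell$ (resp. $t_1\le\dots\le t_\ell$). The strict (resp. non-strict) reachability graph is the digraph on $V$ with arc $(u,v)$, $u\ne v$, iff such a temporal path exists. A labeling is simple if each arc with nonempty label set has exactly one label; proper if no two arcs $(u,v),(v,w)$ forming a directed path share a label; happy if proper and simple. Directed Reachability Graph Realizability: given a simple digraph $D=(V,A)$, decide whether some directed temporal graph on $V$ has reachability graph equal to $D$; variants X-Strict/X-Non-strict (strict/non-strict reachability, X = Any arbitrary labeling or X = Simple simple labeling), Proper, Happy (proper, resp. happy labeling). -}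

module Defs where

open import Data.Nat using (ℕ; _<_; _≤_)
open import Data.Fin using (Fin)
open import Data.Bool using (Bool; true; false)
open import Data.List using (List; []; _∷_; map)
open import Data.List.Membership.Propositional using (_∈_)
open import Data.List.Relation.Unary.Unique.Propositional using (Unique)
open import Data.List.Relation.Unary.Linked using (Linked)
open import Data.Product using (Σ; _×_; proj₁; proj₂; ∃)
open import Data.Sum using (_⊎_)
open import Data.Unit using (⊤)
open import Data.Empty using (⊥)
open import Relation.Nullary using (¬_)
open import Relation.Binary.PropositionalEquality using (_≡_; _≢_)

Digraph : ℕ → Set
Digraph n = Fin n → Fin n → Bool

Loopless : ∀ {n} → Digraph n → Set
Loopless {n} D = (u : Fin n) → D u u ≡ false

-- Directed temporal graph (H, λ): H = (V,B) simple digraph, λ assigns each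
-- arc a finite (possibly empty) set of labels (a list; duplicates irrelevant).
record TemporalGraph (n : ℕ) : Set where
  field
    arc       : Digraph n
    loopless  : Loopless arc
    lab       : Fin n → Fin n → List ℕ
    labOnArcs : (u v : Fin n) → arc u v ≡ false → lab u v ≡ []
open TemporalGraph public

-- A step of a temporal path: next vertex together with the used time label.
Step : ℕ → Set
Step n = Fin n × ℕ

ArcsOK : ∀ {n} → TemporalGraph n → Fin n → List (Step n) → Set
ArcsOK H u [] = ⊤
ArcsOK H u (s ∷ ps) =
  (arc H u (proj₁ s) ≡ true) × (proj₂ s ∈ lab H u (proj₁ s)) × ArcsOK H (proj₁ s) ps

EndsAt : ∀ {n} → Fin n → List (Step n) → Fin n → Set
EndsAt u [] v = u ≡ v
EndsAt u (s ∷ ps) v = EndsAt (proj₁ s) ps v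

TimeRel : Bool → ℕ → ℕ → Set
TimeRel true  = _<_
TimeRel false = _≤_

TemporalPath : ∀ {n} → TemporalGraph n → (strict : Bool) →
               Fin n → List (Step n) → Fin n → Set
TemporalPath H strict u ps v =
  ArcsOK H u ps × EndsAt u ps v × Unique (u ∷ map proj₁ ps) ×
  Linked (TimeRel strict) (map proj₂ ps)

Reach : ∀ {n} → TemporalGraph n → (strict : Bool) → Fin n → Fin n → Set
Reach H strict u v = (u ≢ v) × ∃ (λ ps → TemporalPath H strict u ps v)

SimpleLab : ∀ {n} → TemporalGraph n → Set
SimpleLab {n} H = (u v : Fin n) (t t' : ℕ) →
  t ∈ lab H u v → t' ∈ lab H u v → t ≡ t'

ProperLab : ∀ {n} → TemporalGraph n → Set
ProperLab {n} H = (u v w : Fin n) (t : ℕ) →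
  arc H u v ≡ true → arc H v w ≡ true → u ≢ w →
  t ∈ lab H u v → t ∈ lab H v w → ⊥

HappyLab : ∀ {n} → TemporalGraph n → Set
HappyLab H = ProperLab H × SimpleLab H

data Variant : Set where
  anyStrict anyNonStrict simpleStrict simpleNonStrict proper happy : Variant

-- which reachability notion the variant uses (for proper labelings strict and
-- non-strict reachability coincide; we use strict)
strictness : Variant → Bool
strictness anyStrict       = true
strictness anyNonStrict    = false
strictness simpleStrict    = true
strictness simpleNonStrict = false
strictness proper          = true
strictness happy           = true

Admissible : ∀ {n} → Variant → TemporalGraph n → Set
Admissible anyStrict       H = ⊤
Admissible anyNonStrict    H = ⊤
Admissible simpleStrict    H = SimpleLab H
Admissible simpleNonStrict H = SimpleLab H
Admissible proper          H = ProperLab H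
Admissible happy           H = HappyLab H

Realizable : ∀ {n} → Variant → Digraph n → Set
Realizable {n} var D = Σ (TemporalGraph n) λ H → Admissible var H ×
  ((u v : Fin n) → (D u v ≡ true → Reach H (strictness var) u v) ×
                   (Reach H (strictness var) u v → D u v ≡ true))

Walk : ∀ {n} → Digraph n → Fin n → List (Fin n) → Fin n → Set
Walk D u [] v = u ≡ v
Walk D u (w ∷ ws) v = (D u w ≡ true) × Walk D w ws v

Acyclic : ∀ {n} → Digraph n → Set
Acyclic {n} D = (u : Fin n) (ws : List (Fin n)) → ws ≢ [] → Walk D u ws u → ⊥

Transitive : ∀ {n} → Digraph n → Set
Transitive {n} D = (u v w : Fin n) → u ≢ v → v ≢ w → u ≢ w →
  D u v ≡ true → D v w ≡ true → D u w ≡ true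

-- Label each arc (u,v) with the single time h u, a "potential" of its tail: every arc of D is
-- then a one-step temporal path, the labelling is simple, and it is proper once h differs across
-- every arc.  Longer paths are ruled out by the choice of h.  A constant h gives consecutive arcs
-- equal labels, useless to a strict path.  If D is acyclic, no walk has length n (pigeonhole), so
-- h u = the number of k ≤ n such that a walk of length k leaves u strictly decreases along arcs.
-- If D is transitive, longer paths may exist but end at out-neighbours of their start anyway, and
-- h = toℕ is injective.
module Submission where

open import Defs
open import Data.Nat using (ℕ; zero; suc; _+_; _≤_; _<_; z≤n; s<s)
open import Data.Nat.Properties using (≤-refl; <⇒≤; <⇒≱; <⇒≢; <-irrefl; +-mono-≤-<)
open import Data.Fin using (Fin; toℕ) renaming (zero to fzero; suc to fsuc)
open import Data.Fin.Properties using (pigeonhole; toℕ-injective; any?)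
open import Data.Bool using (Bool; true; false)
open import Data.Bool.Properties using (_≟_)
open import Data.List using (List; []; _∷_; [_]; map)
open import Data.List.Membership.Propositional using (_∈_)
open import Data.List.Relation.Unary.Any using (here; there)
open import Data.List.Relation.Unary.All using (All; []; _∷_)
open import Data.List.Relation.Unary.AllPairs using (AllPairs; []; _∷_)
open import Data.List.Relation.Unary.Linked using ([-]; _∷_)
open import Data.Product using (_×_; _,_; proj₁; ∃)
open import Data.Sum using (_⊎_; inj₁; inj₂)
open import Data.Unit using (⊤; tt)
open import Data.Empty using (⊥-elim)
open import Function using (_∘′_)
open import Relation.Nullary using (¬_; Dec; yes; no; _×-dec_)
open import Relation.Binary.PropositionalEquality using (_≡_; _≢_; refl; sym; trans; subst; subst₂)

TimeRel⇒≤ : ∀ s {a b} → TimeRel s a b → a ≤ b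
TimeRel⇒≤ true  = <⇒≤
TimeRel⇒≤ false = λ a≤b → a≤b

happy⇒admissible : ∀ {n} var {H : TemporalGraph n} → HappyLab H → Admissible var H
happy⇒admissible anyStrict       _          = tt
happy⇒admissible anyNonStrict    _          = tt
happy⇒admissible simpleStrict    (_ , smp)  = smp
happy⇒admissible simpleNonStrict (_ , smp)  = smp
happy⇒admissible proper          (prp , _)  = prp
happy⇒admissible happy           hpy        = hpy

arc⇒≢ : ∀ {n} {D : Digraph n} → Loopless D → ∀ {u v} → D u v ≡ true → u ≢ v
arc⇒≢ ll {u} Duv refl with () ← trans (sym Duv) (ll u)

module PotentialLabelling {n : ℕ} (D : Digraph n) (ll : Loopless D) (h : Fin n → ℕ) where

  arcLabels : Bool → ℕ → List ℕ
  arcLabels true  t = [ t ]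
  arcLabels false t = []

  G : TemporalGraph n
  G = record
    { arc       = D
    ; loopless  = ll
    ; lab       = λ u v → arcLabels (D u v) (h u)
    ; labOnArcs = λ u v Duv → subst (λ b → arcLabels b (h u) ≡ []) (sym Duv) refl
    }

  ∈-lab⇒≡ : ∀ u v {t} → t ∈ lab G u v → t ≡ h u
  ∈-lab⇒≡ u v t∈ with D u v
  ∈-lab⇒≡ u v (here t≡) | true = t≡

  arc⇒∈-lab : ∀ {u v} → D u v ≡ true → h u ∈ lab G u v
  arc⇒∈-lab {u} Duv = subst (λ b → h u ∈ arcLabels b (h u)) (sym Duv) (here refl)

  simpleLab : SimpleLab G
  simpleLab u v t t' t∈ t'∈ = trans (∈-lab⇒≡ u v t∈) (sym (∈-lab⇒≡ u v t'∈))

  properLab : (∀ u v → D u v ≡ true → h u ≢ h v) → ProperLab G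
  properLab separated u v w t Duv _ _ t∈ t∈' =
    separated u v Duv (trans (sym (∈-lab⇒≡ u v t∈)) (∈-lab⇒≡ v w t∈'))

  arc⇒reach : ∀ s {u v} → D u v ≡ true → Reach G s u v
  arc⇒reach s Duv =
    arc⇒≢ ll Duv , [ (_ , _) ] , (Duv , arc⇒∈-lab Duv , tt) , refl ,
    (arc⇒≢ ll Duv ∷ []) ∷ [] ∷ [] , [-]

  reach⇒arc-withoutChains : ∀ s → (∀ u v → D u v ≡ true → ¬ TimeRel s (h u) (h v)) →
                            ∀ u v → Reach G s u v → D u v ≡ true
  reach⇒arc-withoutChains s noChain u v (u≢v , [] , _ , u≡v , _) = ⊥-elim (u≢v u≡v)
  reach⇒arc-withoutChains s noChain u v (_ , _ ∷ [] , (Duw , _) , w≡v , _) =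
    subst (λ x → D u x ≡ true) w≡v Duw
  reach⇒arc-withoutChains s noChain u v
    (_ , (w , t) ∷ (x , t') ∷ _ , (Duw , t∈ , _ , t'∈ , _) , _ , _ , t≺t' ∷ _) =
    ⊥-elim (noChain u w Duw (subst₂ (TimeRel s) (∈-lab⇒≡ u w t∈) (∈-lab⇒≡ w x t'∈) t≺t'))

  transitive⇒arc-to-end : Transitive D → ∀ x u ps v → D x u ≡ true →
    ArcsOK G u ps → EndsAt u ps v →
    AllPairs _≢_ (u ∷ map proj₁ ps) → All (x ≢_) (u ∷ map proj₁ ps) → D x v ≡ true
  transitive⇒arc-to-end T x u [] v Dxu _ u≡v _ _ = subst (λ y → D x y ≡ true) u≡v Dxu
  transitive⇒arc-to-end T x u ((w , _) ∷ ps) v Dxu (Duw , _ , ok) ends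
    ((u≢w ∷ _) ∷ distinct) (x≢u ∷ x≢w ∷ x≢rest) =
    transitive⇒arc-to-end T x w ps v (T x u w x≢u u≢w x≢w Dxu Duw) ok ends distinct
      (x≢w ∷ x≢rest)

  reach⇒arc-transitive : ∀ s → Transitive D → ∀ u v → Reach G s u v → D u v ≡ true
  reach⇒arc-transitive s T u v (u≢v , [] , _ , u≡v , _) = ⊥-elim (u≢v u≡v)
  reach⇒arc-transitive s T u v (_ , (w , _) ∷ ps , (Duw , _ , ok) , ends , (u≢ ∷ distinct) , _) =
    transitive⇒arc-to-end T u w ps v Duw ok ends distinct u≢

  realizes : ∀ var → Admissible var G →
             (∀ u v → Reach G (strictness var) u v → D u v ≡ true) → Realizable var D
  realizes var admissible reach⇒arc =
    G , admissible , λ u v → arc⇒reach (strictness var) , reach⇒arc u v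

module WalkHeight {n : ℕ} (D : Digraph n) where

  HasWalk : ℕ → Fin n → Set
  HasWalk zero    u = ⊤
  HasWalk (suc k) u = ∃ λ v → D u v ≡ true × HasWalk k v

  hasWalk? : ∀ k u → Dec (HasWalk k u)
  hasWalk? zero    u = yes tt
  hasWalk? (suc k) u = any? (λ v → (D u v ≟ true) ×-dec hasWalk? k v)

  trace : ∀ {k u} → HasWalk k u → Fin (suc k) → Fin n
  trace {u = u} _           fzero    = u
  trace {suc k} (_ , _ , w) (fsuc i) = trace w i

  walkFromStart : ∀ {k u} (w : HasWalk k u) j → ∃ λ ws → Walk D u ws (trace w j)
  walkFromStart         _             fzero    = [] , refl
  walkFromStart {suc k} (v , Duv , w) (fsuc j) =
    let ws , walk = walkFromStart w j in v ∷ ws , Duv , walk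

  walkBetween : ∀ {k u} (w : HasWalk k u) {i j} → toℕ i < toℕ j →
                ∃ λ ws → ws ≢ [] × Walk D (trace w i) ws (trace w j)
  walkBetween {suc k} (v , Duv , w) {fzero} {fsuc j} _ =
    let ws , walk = walkFromStart w j in v ∷ ws , (λ ()) , Duv , walk
  walkBetween {suc k} (_ , _ , w) {fsuc i} {fsuc j} (s<s i<j) = walkBetween w i<j

  acyclic⇒¬HasWalk : Acyclic D → ∀ u → ¬ HasWalk n u
  acyclic⇒¬HasWalk acyclic u w =
    let i , j , i<j , same = pigeonhole ≤-refl (trace w)
        ws , nonempty , walk = walkBetween w i<j
    in acyclic (trace w i) ws nonempty (subst (Walk D (trace w i) ws) (sym same) walk)

  indicator : ∀ {A : Set} → Dec A → ℕ
  indicator (yes _) = 1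
  indicator (no _)  = 0

  indicator-mono : ∀ {A B : Set} → (A → B) → (a? : Dec A) (b? : Dec B) →
                   indicator a? ≤ indicator b?
  indicator-mono f (yes _) (yes _) = ≤-refl
  indicator-mono f (yes a) (no ¬b) = ⊥-elim (¬b (f a))
  indicator-mono f (no _)  _       = z≤n

  walkCount : ℕ → Fin n → ℕ
  walkCount zero    u = 0
  walkCount (suc m) u = indicator (hasWalk? m u) + walkCount m u

  arc⇒walkCount< : ∀ m {u v} → D u v ≡ true → walkCount m v < walkCount (suc m) u
  arc⇒walkCount< zero    Duv = s<s z≤n
  arc⇒walkCount< (suc m) {u} {v} Duv =
    +-mono-≤-< (indicator-mono (λ w → v , Duv , w) (hasWalk? m v) (hasWalk? (suc m) u))
               (arc⇒walkCount< m Duv)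

  height : Fin n → ℕ
  height = walkCount (suc n)

  arc⇒height< : Acyclic D → ∀ {u v} → D u v ≡ true → height v < height u
  arc⇒height< acyclic {u} {v} Duv with hasWalk? n v
  ... | yes w = ⊥-elim (acyclic⇒¬HasWalk acyclic v w)
  ... | no _  = arc⇒walkCount< n Duv

lemma58 : (n : ℕ) (D : Digraph n) → Loopless D → (var : Variant) →
    ((var ≡ anyStrict ⊎ var ≡ simpleStrict) ⊎ Acyclic D ⊎ Transitive D) →
    Realizable var D
lemma58 n D ll .anyStrict (inj₁ (inj₁ refl)) =
  realizes anyStrict tt (reach⇒arc-withoutChains true λ _ _ _ → <-irrefl refl)
  where open PotentialLabelling D ll (λ _ → 0)
lemma58 n D ll .simpleStrict (inj₁ (inj₂ refl)) =
  realizes simpleStrict simpleLab (reach⇒arc-withoutChains true λ _ _ _ → <-irrefl refl)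
  where open PotentialLabelling D ll (λ _ → 0)
lemma58 n D ll var (inj₂ (inj₁ acyclic)) =
  realizes var (happy⇒admissible var (properLab heightSeparates , simpleLab))
    (reach⇒arc-withoutChains s λ u v Duv → <⇒≱ (arc⇒height< acyclic Duv) ∘′ TimeRel⇒≤ s)
  where
  open WalkHeight D
  open PotentialLabelling D ll height
  s : Bool
  s = strictness var
  heightSeparates : ∀ u v → D u v ≡ true → height u ≢ height v
  heightSeparates u v Duv = <⇒≢ (arc⇒height< acyclic Duv) ∘′ sym
lemma58 n D ll var (inj₂ (inj₂ transitive)) =
  realizes var (happy⇒admissible var (properLab toℕSeparates , simpleLab))
    (reach⇒arc-transitive (strictness var) transitive)
  where
  open PotentialLabelling D ll toℕ
  toℕSeparates : ∀ u v → D u v ≡ true → toℕ u ≢ toℕ v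
  toℕSeparates u v Duv = arc⇒≢ ll Duv ∘′ toℕ-injective
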